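{- For all positive integers $n,d$, the maximum diameter among all normal pure multicomplexes of rank $d$ on $n$ elements is at most $H_{\mathrm{c.l.m.}}(n,d)$.
   Context: A pure multicomplex of rank $d$ on an $n$-element set $V$ is a nonempty collection $M$ of multisets of size $d$ of elements of $V$ (its facets); a face is a submultiset of a facet. Multiset operations are taken with multiplicities (intersection = minimum multiplicity, difference counts multiplicities). The dual graph of $M$ has the facets as vertices, two facets $X,Y$ adjacent when $|X\setminus Y|=1$ (as multisets); the diameter of $M$ is the diameter of this graph. $M$ is strongly connected if the dual graph is connected. The link of a face $S$ is $\mathrm{lk}_M(S)=\{X\setminus S: S\subseteq X\in M\}$, and $M$ is normal if the link of every face (including the empty face) is strongly connected. A connected layer multicomplex (c.l.m.) is a pure multicomplex $M$ with a partition $M=L_a\sqcup L_{a+1}\sqcup\dots\sqcup L_b$ ($a\le b$ integers) of its facets into nonempty layers such that for every multiset $S$, the set of indices $i$ for which $L_i$ contains a facet containing $S$ is an interval of integers. Its length is $b-a$. $H_{\mathrm{c.l.m.}}(n,d)$ is the maximum length of c.l.m.'s of rank $d$ on an $n$-element set. -}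

module Defs where

open import Data.Nat using (ℕ; zero; suc; _≤_; _∸_)
open import Data.Fin as Fin using (Fin)
open import Data.Vec using (Vec; lookup; zipWith; sum)
open import Data.List using (List; [])
open import Data.List.Membership.Propositional using (_∈_)
open import Data.Product using (Σ; ∃; _×_)
open import Relation.Binary.PropositionalEquality using (_≡_; _≢_)

-- A multiset of elements of the n-element set V = Fin n,
-- given by its multiplicity vector.
Multiset : ℕ → Set
Multiset n = Vec ℕ n

size : ∀ {n} → Multiset n → ℕ
size X = sum X

_⊆ₘ_ : ∀ {n} → Multiset n → Multiset n → Set
S ⊆ₘ X = ∀ i → lookup S i ≤ lookup X i

_∖ₘ_ : ∀ {n} → Multiset n → Multiset n → Multiset n
X ∖ₘ Y = zipWith _∸_ X Y

Adjacent : ∀ {n} → Multiset n → Multiset n → Set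
Adjacent X Y = size (X ∖ₘ Y) ≡ 1

data Walk {n} (F : Multiset n → Set) : Multiset n → Multiset n → ℕ → Set where
  stay : ∀ {X} → F X → Walk F X X 0
  step : ∀ {X Y Z k} → F X → Adjacent X Y → Walk F Y Z k → Walk F X Z (suc k)

StronglyConnected : ∀ {n} → (Multiset n → Set) → Set
StronglyConnected F = ∀ X Y → F X → F Y → ∃ λ k → Walk F X Y k

DiameterAtMost : ∀ {n} → (Multiset n → Set) → ℕ → Set
DiameterAtMost F L = ∀ X Y → F X → F Y → ∃ λ k → k ≤ L × Walk F X Y k

-- pure multicomplex of rank d on Fin n, given by its list of facets
IsPureMulticomplex : ∀ {n} → ℕ → List (Multiset n) → Set
IsPureMulticomplex d M = (M ≢ []) × (∀ X → X ∈ M → size X ≡ d)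

IsFace : ∀ {n} → List (Multiset n) → Multiset n → Set
IsFace M S = ∃ λ X → X ∈ M × S ⊆ₘ X

Link : ∀ {n} → List (Multiset n) → Multiset n → Multiset n → Set
Link M S Z = ∃ λ X → X ∈ M × S ⊆ₘ X × Z ≡ X ∖ₘ S

Normal : ∀ {n} → List (Multiset n) → Set
Normal M = ∀ S → IsFace M S → StronglyConnected (Link M S)

-- Layers are indexed
-- L_0, ..., L_len (shifting a to 0; the length b - a is len).
record CLM (n d : ℕ) : Set where
  field
    len       : ℕ
    layers    : Vec (List (Multiset n)) (suc len)
    nonempty  : ∀ i → lookup layers i ≢ []
    rank      : ∀ i X → X ∈ lookup layers i → size X ≡ d
    disjoint  : ∀ i j X → X ∈ lookup layers i → X ∈ lookup layers j → i ≡ j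
    interval  : ∀ (S : Multiset n) (i j k : Fin (suc len)) →
                i Fin.≤ j → j Fin.≤ k →
                (∃ λ X → X ∈ lookup layers i × S ⊆ₘ X) →
                (∃ λ X → X ∈ lookup layers k × S ⊆ₘ X) →
                (∃ λ X → X ∈ lookup layers j × S ⊆ₘ X)

-- Lay the facets out in spheres around a facet O of maximal eccentricity:
-- layer j consists of the facets at dual-graph distance j from O, so there
-- are diameter + 1 layers.  Distance from O changes by at most one along an
-- edge, so a shortest walk from O to a farthest facet meets every layer.
-- For the interval property, normality makes the link, hence the star, of
-- any face S strongly connected, and a walk inside the star of S between
-- facets in layers i ≤ k meets every layer in between.
module Submission where

open import Defs
open import Data.Nat using (ℕ; _≤_; zero; suc; _+_; _⊔_; z≤n; s≤s⁻¹; _≟_)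
open import Data.Nat.Properties
open import Data.Fin as Fin using (Fin; toℕ)
open import Data.Fin.Properties using (toℕ-injective; toℕ<n)
open import Data.Vec using (Vec; []; _∷_; zipWith; lookup; tabulate; replicate)
open import Data.Vec.Properties using (≡-dec; lookup∘tabulate; lookup-replicate)
open import Data.List using (List; []; _∷_; filter)
open import Data.List.Relation.Unary.Any using (here; there; any?)
open import Data.List.Relation.Unary.Any.Properties using (¬Any[])
import Data.List.Relation.Unary.All as All
open import Data.List.Membership.Propositional using (_∈_; find; lose)
open import Data.List.Membership.Propositional.Properties using (∈-filter⁺; ∈-filter⁻)
import Data.List.Membership.DecPropositional as DecMembership
open import Data.List.Extrema.Nat using (argmax; argmax-all; f[xs]≤f[argmax])
open import Data.Product using (∃; _×_; _,_; proj₁; proj₂)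
open import Data.Sum using (inj₁; inj₂)
open import Data.Empty using (⊥-elim)
open import Relation.Nullary using (Dec; yes; no)
open import Relation.Nullary.Decidable using (_×-dec_)
open import Relation.Unary using (Decidable)
open import Relation.Binary.PropositionalEquality
open import Function using (_∘_)

private
  variable
    n : ℕ
    F G : Multiset n → Set

walk-source : ∀ {X Y k} → Walk F X Y k → F X
walk-source (stay FX)     = FX
walk-source (step FX _ _) = FX

walk-snoc : ∀ {X Y Z k} → Walk F X Y k → F Z → Adjacent Y Z → Walk F X Z (suc k)
walk-snoc (stay FY)       FZ YZ = step FY YZ (stay FZ)
walk-snoc (step FX XW w)  FZ YZ = step FX XW (walk-snoc w FZ YZ)

walk-map : (φ : Multiset n → Multiset n) → (∀ {A} → F A → G (φ A)) →
           (∀ {A B} → F A → F B → Adjacent A B → Adjacent (φ A) (φ B)) →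
           ∀ {X Y k} → Walk F X Y k → Walk G (φ X) (φ Y) k
walk-map φ φ-F φ-adj (stay FX)      = stay (φ-F FX)
walk-map φ φ-F φ-adj (step FX XY w) =
  step (φ-F FX) (φ-adj FX (walk-source w) XY) (walk-map φ φ-F φ-adj w)

walk-weaken : (∀ {A} → F A → G A) → ∀ {X Y k} → Walk F X Y k → Walk G X Y k
walk-weaken F⊆G = walk-map (λ A → A) F⊆G (λ _ _ AB → AB)

walk-intermediate-value :
  (h : Multiset n → ℕ) → (∀ {A B} → F A → F B → Adjacent A B → h B ≤ suc (h A)) →
  ∀ {X Y k} → Walk F X Y k → ∀ j → h X ≤ j → j ≤ h Y → ∃ λ C → F C × h C ≡ j
walk-intermediate-value h h-lip (stay FX) j hX≤j j≤hX = _ , FX , ≤-antisym hX≤j j≤hX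
walk-intermediate-value h h-lip {X} (step FX XY w) j hX≤j j≤hY with h X ≟ j
... | yes hX≡j = X , FX , hX≡j
... | no  hX≢j = walk-intermediate-value h h-lip w j
                   (≤-trans (h-lip FX (walk-source w) XY) (≤∧≢⇒< hX≤j hX≢j)) j≤hY

walk? : (M : List (Multiset n)) → ∀ k X Y → Dec (Walk (_∈ M) X Y k)
walk? M zero X Y with X ∈? M | ≡-dec _≟_ X Y
  where open DecMembership (≡-dec _≟_)
... | yes X∈M | yes refl = yes (stay X∈M)
... | no  X∉M | _        = no λ { (stay X∈M) → X∉M X∈M }
... | _       | no  X≢Y  = no λ { (stay _) → X≢Y refl }
walk? M (suc k) X Z
  with X ∈? M | any? (λ Y → (size (X ∖ₘ Y) ≟ 1) ×-dec walk? M k Y Z) M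
  where open DecMembership (≡-dec _≟_)
... | yes X∈M | yes next  = let _ , _ , XY , w = find next in yes (step X∈M XY w)
... | no  X∉M | _         = no λ { (step X∈M _ _) → X∉M X∈M }
... | _       | no  ¬next = no λ { (step _ XY w) → ¬next (lose (walk-source w) (XY , w)) }

-- μ B is the least k ≤ B with P k, provided there is one (otherwise it is B).
module Minimise {P : ℕ → Set} (P? : Decidable P) where

  μ : ℕ → ℕ
  μ zero = zero
  μ (suc B) with P? (μ B)
  ... | yes _ = μ B
  ... | no  _ = suc B

  μ≤ : ∀ B → μ B ≤ B
  μ≤ zero = z≤n
  μ≤ (suc B) with P? (μ B)
  ... | yes _ = m≤n⇒m≤1+n (μ≤ B)
  ... | no  _ = ≤-refl

  μ-least : ∀ {k} B → P k → k ≤ B → P (μ B) × μ B ≤ k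
  μ-least zero Pk z≤n = Pk , z≤n
  μ-least (suc B) Pk k≤1+B with P? (μ B) | m≤n⇒m<n∨m≡n k≤1+B
  ... | yes Pμ | inj₁ k≤B  = Pμ , proj₂ (μ-least B Pk (s≤s⁻¹ k≤B))
  ... | yes Pμ | inj₂ refl = Pμ , m≤n⇒m≤1+n (μ≤ B)
  ... | no ¬Pμ | inj₁ k≤B  = ⊥-elim (¬Pμ (proj₁ (μ-least B Pk (s≤s⁻¹ k≤B))))
  ... | no  _  | inj₂ refl = Pk , ≤-refl

uniform-bound : ∀ {A : Set} (xs : List A) (P : A → ℕ → Set) →
  (∀ {x} → x ∈ xs → ∃ (P x)) → ∃ λ B → ∀ {x} → x ∈ xs → ∃ λ k → k ≤ B × P x k
uniform-bound [] P witness = 0 , λ ()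
uniform-bound (x ∷ xs) P witness with witness (here refl) | uniform-bound xs P (witness ∘ there)
... | k , Pxk | B , bounded = k ⊔ B , λ
  { (here refl) → k , m≤m⊔n k B , Pxk
  ; (there y∈xs) → let k′ , k′≤B , Pyk′ = bounded y∈xs in k′ , ≤-trans k′≤B (m≤n⊔m k B) , Pyk′ }

_+ₘ_ : Multiset n → Multiset n → Multiset n
S +ₘ A = zipWith _+_ S A

∅ₘ : Multiset n
∅ₘ = replicate _ 0

∅ₘ-⊆ₘ : (X : Multiset n) → ∅ₘ ⊆ₘ X
∅ₘ-⊆ₘ X i rewrite lookup-replicate i 0 = z≤n

⊆ₘ-+ₘ : (S A : Multiset n) → S ⊆ₘ (S +ₘ A)
⊆ₘ-+ₘ (s ∷ S) (a ∷ A) Fin.zero    = m≤m+n s a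
⊆ₘ-+ₘ (s ∷ S) (a ∷ A) (Fin.suc i) = ⊆ₘ-+ₘ S A i

+ₘ-∖ₘ : {S X : Multiset n} → S ⊆ₘ X → S +ₘ (X ∖ₘ S) ≡ X
+ₘ-∖ₘ {S = []}    {[]}    S⊆X = refl
+ₘ-∖ₘ {S = s ∷ S} {x ∷ X} S⊆X = cong₂ _∷_ (m+[n∸m]≡n (S⊆X Fin.zero)) (+ₘ-∖ₘ (S⊆X ∘ Fin.suc))

+ₘ-∖ₘ-cancelˡ : (S A B : Multiset n) → (S +ₘ A) ∖ₘ (S +ₘ B) ≡ A ∖ₘ B
+ₘ-∖ₘ-cancelˡ []      []      []      = refl
+ₘ-∖ₘ-cancelˡ (s ∷ S) (a ∷ A) (b ∷ B) = cong₂ _∷_ ([m+n]∸[m+o]≡n∸o s a b) (+ₘ-∖ₘ-cancelˡ S A B)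

Star : List (Multiset n) → Multiset n → Multiset n → Set
Star M S X = X ∈ M × S ⊆ₘ X

-- Adding S back is an isomorphism from the link of S onto the star of S.
link-walk⇒star-walk : ∀ {M : List (Multiset n)} {S X Y k} → S ⊆ₘ X → S ⊆ₘ Y →
  Walk (Link M S) (X ∖ₘ S) (Y ∖ₘ S) k → Walk (Star M S) X Y k
link-walk⇒star-walk {M = M} {S} S⊆X S⊆Y w =
  subst₂ (λ A B → Walk (Star M S) A B _) (+ₘ-∖ₘ S⊆X) (+ₘ-∖ₘ S⊆Y)
    (walk-map (S +ₘ_) link⇒star (λ _ _ AB → trans (cong size (+ₘ-∖ₘ-cancelˡ S _ _)) AB) w)
  where
  link⇒star : ∀ {A} → Link M S A → Star M S (S +ₘ A)
  link⇒star (W , W∈M , S⊆W , refl) = subst (_∈ M) (sym (+ₘ-∖ₘ S⊆W)) W∈M , ⊆ₘ-+ₘ S _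

normal⇒star-connected : ∀ {M : List (Multiset n)} {S} → Normal M → StronglyConnected (Star M S)
normal⇒star-connected {M = M} {S} normal X Y (X∈M , S⊆X) (Y∈M , S⊆Y) =
  let k , w = normal S (X , X∈M , S⊆X) (X ∖ₘ S) (Y ∖ₘ S)
                (X , X∈M , S⊆X , refl) (Y , Y∈M , S⊆Y , refl)
  in k , link-walk⇒star-walk S⊆X S⊆Y w

normal⇒strongly-connected : ∀ {M : List (Multiset n)} → Normal M → StronglyConnected (_∈ M)
normal⇒strongly-connected normal X Y X∈M Y∈M =
  let k , w = normal⇒star-connected {S = ∅ₘ} normal X Y (X∈M , ∅ₘ-⊆ₘ X) (Y∈M , ∅ₘ-⊆ₘ Y)
  in k , walk-weaken proj₁ w

strongly-connected⇒bounded-diameter : ∀ {M : List (Multiset n)} →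
  StronglyConnected (_∈ M) → ∃ (DiameterAtMost (_∈ M))
strongly-connected⇒bounded-diameter {M = M} connected =
  let B , eccentricity≤B = uniform-bound M Eccentricity≤ (λ X∈M →
        uniform-bound M (Walk (_∈ M) _) (connected _ _ X∈M))
  in B , λ X Y X∈M Y∈M →
    let e , e≤B , reach = eccentricity≤B X∈M
        k , k≤e , w     = reach Y∈M
    in k , ≤-trans k≤e e≤B , w
  where
  Eccentricity≤ : Multiset _ → ℕ → Set
  Eccentricity≤ X e = ∀ {Y} → Y ∈ M → ∃ λ k → k ≤ e × Walk (_∈ M) X Y k

module Distance (M : List (Multiset n)) (connected : StronglyConnected (_∈ M)) where

  private
    B : ℕ
    B = proj₁ (strongly-connected⇒bounded-diameter connected)

    open module Shortest {X Y : Multiset n} = Minimise (λ k → walk? M k X Y)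

  dist : Multiset n → Multiset n → ℕ
  dist X Y = μ {X} {Y} B

  dist-shortest : ∀ {X Y} → X ∈ M → Y ∈ M → Walk (_∈ M) X Y (dist X Y)
  dist-shortest X∈M Y∈M =
    let k , k≤B , w = proj₂ (strongly-connected⇒bounded-diameter connected) _ _ X∈M Y∈M
    in proj₁ (μ-least B w k≤B)

  dist-minimal : ∀ {X Y k} → Walk (_∈ M) X Y k → dist X Y ≤ k
  dist-minimal {k = k} w with ≤-total k B
  ... | inj₁ k≤B = proj₂ (μ-least B w k≤B)
  ... | inj₂ B≤k = ≤-trans (μ≤ B) B≤k

  dist-self : ∀ {X} → X ∈ M → dist X X ≡ 0
  dist-self X∈M = n≤0⇒n≡0 (dist-minimal (stay X∈M))

  dist-lipschitz : ∀ {X Y Z} → X ∈ M → Y ∈ M → Z ∈ M → Adjacent Y Z → dist X Z ≤ suc (dist X Y)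
  dist-lipschitz X∈M Y∈M Z∈M YZ = dist-minimal (walk-snoc (dist-shortest X∈M Y∈M) Z∈M YZ)

  ∈-argmax : ∀ {X} (f : Multiset n → ℕ) → X ∈ M → argmax f X M ∈ M
  ∈-argmax f X∈M = argmax-all f X∈M (All.tabulate (λ Y∈M → Y∈M))

  farthest : Multiset n → Multiset n
  farthest X = argmax (dist X) X M

  eccentricity : Multiset n → ℕ
  eccentricity X = dist X (farthest X)

  dist≤eccentricity : ∀ {X Y} → Y ∈ M → dist X Y ≤ eccentricity X
  dist≤eccentricity {X} Y∈M = All.lookup (f[xs]≤f[argmax] {f = dist X} X M) Y∈M

  peripheral : Multiset n → Multiset n
  peripheral X = argmax eccentricity X M

  diameter≤eccentricity-peripheral : ∀ X₀ → DiameterAtMost (_∈ M) (eccentricity (peripheral X₀))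
  diameter≤eccentricity-peripheral X₀ Y Z Y∈M Z∈M =
    dist Y Z ,
    ≤-trans (dist≤eccentricity Z∈M) (All.lookup (f[xs]≤f[argmax] {f = eccentricity} X₀ M) Y∈M) ,
    dist-shortest Y∈M Z∈M

module Spheres {d} {M : List (Multiset n)} (pure : IsPureMulticomplex d M) (normal : Normal M)
               (O : Multiset n) (O∈M : O ∈ M) where

  open Distance M (normal⇒strongly-connected normal)

  sphere : ℕ → List (Multiset n)
  sphere j = filter (λ Z → dist O Z ≟ j) M

  sphere-inhabited : ∀ {j} → j ≤ eccentricity O → ∃ λ C → C ∈ M × dist O C ≡ j
  sphere-inhabited {j} j≤ecc =
    walk-intermediate-value (dist O) (dist-lipschitz O∈M)
      (dist-shortest O∈M (∈-argmax (dist O) O∈M)) j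
      (subst (_≤ j) (sym (dist-self O∈M)) z≤n) j≤ecc

  star-meets-spheres-between : ∀ {S X Z j} → Star M S X → Star M S Z →
    dist O X ≤ j → j ≤ dist O Z → ∃ λ C → Star M S C × dist O C ≡ j
  star-meets-spheres-between {S} {j = j} SX SZ =
    let _ , w = normal⇒star-connected {S = S} normal _ _ SX SZ
    in walk-intermediate-value (dist O) (λ SA SB → dist-lipschitz O∈M (proj₁ SA) (proj₁ SB)) w j

  layers : Vec (List (Multiset n)) (suc (eccentricity O))
  layers = tabulate (sphere ∘ toℕ)

  ∈-layer⁻ : ∀ j {X} → X ∈ lookup layers j → X ∈ M × dist O X ≡ toℕ j
  ∈-layer⁻ j X∈Lj =
    ∈-filter⁻ (λ Z → dist O Z ≟ toℕ j) (subst (_ ∈_) (lookup∘tabulate (sphere ∘ toℕ) j) X∈Lj)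

  ∈-layer⁺ : ∀ j {X} → X ∈ M → dist O X ≡ toℕ j → X ∈ lookup layers j
  ∈-layer⁺ j X∈M dX≡j =
    subst (_ ∈_) (sym (lookup∘tabulate (sphere ∘ toℕ) j)) (∈-filter⁺ (λ Z → dist O Z ≟ toℕ j) X∈M dX≡j)

  layer-nonempty : ∀ j → lookup layers j ≢ []
  layer-nonempty j Lj≡[] =
    let C , C∈M , dC≡j = sphere-inhabited (s≤s⁻¹ (toℕ<n j))
    in ¬Any[] (subst (C ∈_) Lj≡[] (∈-layer⁺ j C∈M dC≡j))

  layers-interval : ∀ (S : Multiset n) (i j k : Fin (suc (eccentricity O))) → i Fin.≤ j → j Fin.≤ k →
                    (∃ λ X → X ∈ lookup layers i × S ⊆ₘ X) →
                    (∃ λ X → X ∈ lookup layers k × S ⊆ₘ X) →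
                    (∃ λ X → X ∈ lookup layers j × S ⊆ₘ X)
  layers-interval S i j k i≤j j≤k (X , X∈Li , S⊆X) (Z , Z∈Lk , S⊆Z) =
    let X∈M , dX≡i = ∈-layer⁻ i X∈Li
        Z∈M , dZ≡k = ∈-layer⁻ k Z∈Lk
        C , (C∈M , S⊆C) , dC≡j = star-meets-spheres-between {S = S} (X∈M , S⊆X) (Z∈M , S⊆Z)
                                   (subst (_≤ toℕ j) (sym dX≡i) i≤j) (subst (toℕ j ≤_) (sym dZ≡k) j≤k)
    in C , ∈-layer⁺ j C∈M dC≡j , S⊆C

  layering : CLM n d
  layering = record
    { len      = eccentricity O
    ; layers   = layers
    ; nonempty = layer-nonempty
    ; rank     = λ j X X∈Lj → proj₂ pure X (proj₁ (∈-layer⁻ j X∈Lj))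
    ; disjoint = λ i j X X∈Li X∈Lj →
        toℕ-injective (trans (sym (proj₂ (∈-layer⁻ i X∈Li))) (proj₂ (∈-layer⁻ j X∈Lj)))
    ; interval = layers-interval
    }

nonempty⇒∃∈ : ∀ {A : Set} {xs : List A} → xs ≢ [] → ∃ (_∈ xs)
nonempty⇒∃∈ {xs = []}    []≢[] = ⊥-elim ([]≢[] refl)
nonempty⇒∃∈ {xs = x ∷ _} _     = x , here refl

proposition3p7 : ∀ (n d : ℕ) → 1 ≤ n → 1 ≤ d →
    (M : List (Multiset n)) → IsPureMulticomplex d M → Normal M →
    ∃ λ (C : CLM n d) → DiameterAtMost (λ X → X ∈ M) (CLM.len C)
proposition3p7 n d _ _ M pure normal =
  let X , X∈M = nonempty⇒∃∈ (proj₁ pure)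
  in Spheres.layering pure normal (peripheral X) (∈-argmax eccentricity X∈M) ,
     diameter≤eccentricity-peripheral X
  where open Distance M (normal⇒strongly-connected normal)
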